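{- Let $G$ be a biconnected undirected graph that is not a single edge, with SPQR tree $\mathcal{T}$, and let $S$ be a set of three elements of $G$. If $C$ is a component of $\mathcal{T}$ central with respect to $S$ such that all three elements of $S$ are represented in $C$ by edges (real or virtual), then $C$ is the unique component of $\mathcal{T}$ central with respect to $S$.
   Context: Elements of a graph are its vertices and edges. The SPQR tree $\mathcal{T}=\mathcal{T}(G)$ of a biconnected graph $G$ (not a single edge) is the standard decomposition of $G$ into triconnected components (Di Battista–Tamassia, in the version without Q-nodes, considered unrooted): its nodes are components, each of type S (a cycle), P (a multigraph on two vertices with at least three parallel edges) or R (a simple triconnected graph on at least four vertices). Each component consists of vertices of $G$, some edges of $G$ (real edges) and virtual edges; every edge of $G$ is a real edge of exactly one component; every virtual edge occurs in exactly two components, joined by the corresponding tree edge of $\mathcal{T}$. For a virtual edge $e=(a,b)$ of a component $C$, with corresponding tree edge $(C,C')$, let $B(C,e)$ be the subtree of $\mathcal{T}$ containing $C'$ after removing $(C,C')$, and let $G(C,e)$ be the subgraph of $G$ formed by all vertices and real edges occurring in the components of $B(C,e)$. The real elements of $C$ are its vertices and real edges. For an element $x$ of $G$, the representative $r_C(x)$ is $x$ if $x$ is a real element of $C$, and otherwise the unique virtual edge $e=(a,b)$ of $C$ such that $x$ is an element of $G(C,e)$ other than $a,b$; $x$ is said to be represented in $C$ by $r_C(x)$. A component $C$ is central with respect to $S$ if the representatives $r_C(x)$, $x\in S$, are pairwise distinct. -}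

module Defs where

open import Data.Nat using (ℕ; suc; _≤_)
open import Data.Fin using (Fin; zero; suc; fromℕ; inject₁)
open import Data.Fin.Subset using (Subset) renaming (_∈_ to _∈ₛ_)
open import Data.Product using (Σ; ∃; _×_; _,_; proj₁; proj₂)
open import Data.Sum using (_⊎_)
open import Data.Unit using (⊤)
open import Data.Empty using (⊥)
open import Relation.Nullary using (¬_)
open import Relation.Binary.PropositionalEquality using (_≡_; _≢_)
open import Data.List using (List)
open import Data.List.Membership.Propositional using () renaming (_∈_ to _∈ₗ_)
open import Function.Definitions using (Injective)

SameEnds : {V : Set} → V × V → V × V → Set
SameEnds (a , b) (c , d) = (a ≡ c × b ≡ d) ⊎ (a ≡ d × b ≡ c)

module Walk {V E : Set} (ends : E → V × V) (okV : V → Set) (okE : E → Set) where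
  data Reach : V → V → Set where
    here : ∀ {u} → Reach u u
    step : ∀ {u w z} (e : E) → okE e → SameEnds (ends e) (u , w) →
           okV w → Reach w z → Reach u z

  Connected : Set
  Connected = ∀ u w → okV u → okV w → Reach u w

record Graph : Set where
  field
    nV nE    : ℕ
    ends     : Fin nE → Fin nV × Fin nV
    loopless : ∀ e → proj₁ (ends e) ≢ proj₂ (ends e)

module _ (G : Graph) where
  open Graph G

  data Elem : Set where
    vtx : Fin nV → Elem
    edg : Fin nE → Elem

  ConnectedMinus : Fin nV → Set
  ConnectedMinus x = Walk.Connected ends (λ v → v ≢ x) (λ _ → ⊤)

  Biconnected : Set
  Biconnected = (2 ≤ nV) × Walk.Connected ends (λ _ → ⊤) (λ _ → ⊤)
              × (∀ x → ConnectedMinus x)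

  SingleEdge : Set
  SingleEdge = (nV ≡ 2) × (nE ≡ 1)

-- Raw data of a decomposition tree of G into skeletons.
-- Nodes: Fin nN; tree edges: Fin nT with endpoints tends.
-- vin N : vertex set of the skeleton of N (a set of vertices of G).
-- home e : the unique component in which the edge e of G is real.
-- The tree edge t carries a virtual edge with endpoints vends t, which
-- occurs in exactly the two components joined by t.

record TreeData (G : Graph) : Set where
  open Graph G
  field
    nN nT : ℕ
    tends : Fin nT → Fin nN × Fin nN
    vin   : Fin nN → Subset nV
    home  : Fin nE → Fin nN
    vends : Fin nT → Fin nV × Fin nV

module _ {G : Graph} (D : TreeData G) where
  open Graph G
  open TreeData D

  Incident : Fin nT → Fin nN → Set
  Incident t N = (proj₁ (tends t) ≡ N) ⊎ (proj₂ (tends t) ≡ N)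

  -- edge identifiers of skeletons: real edges (edges of G) or virtual edges
  EId : Set
  EId = Fin nE ⊎ Fin nT

  eends : EId → Fin nV × Fin nV
  eends (Data.Sum.inj₁ e) = ends e
  eends (Data.Sum.inj₂ t) = vends t

  InSkel : Fin nN → EId → Set
  InSkel N (Data.Sum.inj₁ e) = home e ≡ N
  InSkel N (Data.Sum.inj₂ t) = Incident t N

  -- skeleton of N is a cycle with k = suc m ≥ 3 edges
  IsCycle : Fin nN → Set
  IsCycle N = Σ ℕ λ m → (2 ≤ m) ×
    Σ (Fin (suc m) → Fin nV) λ vs → Σ (Fin (suc m) → EId) λ es →
      Injective _≡_ _≡_ vs × (∀ i → vs i ∈ₛ vin N) ×
      (∀ v → v ∈ₛ vin N → ∃ λ i → vs i ≡ v) ×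
      Injective _≡_ _≡_ es × (∀ i → InSkel N (es i)) ×
      (∀ s → InSkel N s → ∃ λ i → es i ≡ s) ×
      (∀ (i : Fin m) → SameEnds (eends (es (inject₁ i))) (vs (inject₁ i) , vs (suc i))) ×
      SameEnds (eends (es (fromℕ m))) (vs (fromℕ m) , vs zero)

  IsBond : Fin nN → Set
  IsBond N = Σ (Fin nV) λ a → Σ (Fin nV) λ b → (a ≢ b) ×
    (∀ v → v ∈ₛ vin N → (v ≡ a) ⊎ (v ≡ b)) × a ∈ₛ vin N × b ∈ₛ vin N ×
    (Σ EId λ s₁ → Σ EId λ s₂ → Σ EId λ s₃ →
       InSkel N s₁ × InSkel N s₂ × InSkel N s₃ ×
       s₁ ≢ s₂ × s₁ ≢ s₃ × s₂ ≢ s₃) ×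
    (∀ s → InSkel N s → SameEnds (eends s) (a , b))

  SkelConnectedMinus : Fin nN → Fin nV → Fin nV → Set
  SkelConnectedMinus N x y =
    Walk.Connected eends (λ v → v ∈ₛ vin N × v ≢ x × v ≢ y) (InSkel N)

  IsTriconnected : Fin nN → Set
  IsTriconnected N =
    (Σ (Fin nV) λ v₁ → Σ (Fin nV) λ v₂ → Σ (Fin nV) λ v₃ → Σ (Fin nV) λ v₄ →
       v₁ ∈ₛ vin N × v₂ ∈ₛ vin N × v₃ ∈ₛ vin N × v₄ ∈ₛ vin N ×
       v₁ ≢ v₂ × v₁ ≢ v₃ × v₁ ≢ v₄ × v₂ ≢ v₃ × v₂ ≢ v₄ × v₃ ≢ v₄) ×
    (∀ s → InSkel N s → proj₁ (eends s) ≢ proj₂ (eends s)) ×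
    (∀ s s' → InSkel N s → InSkel N s' → SameEnds (eends s) (eends s') → s ≡ s') ×
    (∀ x y → SkelConnectedMinus N x y)

  record IsSPQRTree : Set where
    field
      treeConnected : Walk.Connected tends (λ _ → ⊤) (λ _ → ⊤)
      treeSize      : nN ≡ suc nT
      skelEnds      : ∀ N s → InSkel N s →
                      (proj₁ (eends s) ∈ₛ vin N) × (proj₂ (eends s) ∈ₛ vin N)
      skelType      : ∀ N → IsCycle N ⊎ IsBond N ⊎ IsTriconnected N
      -- maximality (uniqueness) conditions: no S–S and no P–P tree edges
      noSS          : ∀ t → ¬ (IsCycle (proj₁ (tends t)) × IsCycle (proj₂ (tends t)))
      noPP          : ∀ t → ¬ (IsBond (proj₁ (tends t)) × IsBond (proj₂ (tends t)))
      -- G is the 2-sum of the skeletons along the tree edges: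
      -- adjacent components share exactly the endpoints of their virtual edge,
      separation    : ∀ t v → v ∈ₛ vin (proj₁ (tends t)) → v ∈ₛ vin (proj₂ (tends t)) →
                      (v ≡ proj₁ (vends t)) ⊎ (v ≡ proj₂ (vends t))
      vertexSubtree : ∀ v → Walk.Connected tends (λ N → v ∈ₛ vin N) (λ _ → ⊤)
      vertexCover   : ∀ v → ∃ λ N → v ∈ₛ vin N
      -- (every edge of G is real in exactly one component: the field home)

  ReachAvoiding : Fin nT → Fin nN → Fin nN → Set
  ReachAvoiding t = Walk.Reach tends (λ _ → ⊤) (λ t' → t' ≢ t)

  -- M is a node of B(N,t): the subtree containing the other endpoint of t
  -- after removing t
  InB : Fin nN → Fin nT → Fin nN → Set
  InB N t M = (proj₁ (tends t) ≡ N × ReachAvoiding t (proj₂ (tends t)) M)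
            ⊎ (proj₂ (tends t) ≡ N × ReachAvoiding t (proj₁ (tends t)) M)

  InGsub : Fin nN → Fin nT → Elem G → Set
  InGsub N t (vtx v) = ∃ λ M → InB N t M × v ∈ₛ vin M
  InGsub N t (edg e) = InB N t (home e)

  Real : Fin nN → Elem G → Set
  Real N (vtx v) = v ∈ₛ vin N
  Real N (edg e) = home e ≡ N

  data RElem : Set where
    rv : Fin nV → RElem
    re : Fin nE → RElem
    rt : Fin nT → RElem

  IsEdgeR : RElem → Set
  IsEdgeR (rv _) = ⊥
  IsEdgeR (re _) = ⊤
  IsEdgeR (rt _) = ⊤

  data Rep (N : Fin nN) : Elem G → RElem → Set where
    rep-v : ∀ {v} → v ∈ₛ vin N → Rep N (vtx v) (rv v)
    rep-e : ∀ {e} → home e ≡ N → Rep N (edg e) (re e)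
    rep-t : ∀ {x t} → Incident t N → ¬ Real N x → InGsub N t x →
            x ≢ vtx (proj₁ (vends t)) → x ≢ vtx (proj₂ (vends t)) →
            Rep N x (rt t)

  Central : Fin nN → List (Elem G) → Set
  Central N S = ∀ x y r → x ∈ₗ S → y ∈ₗ S → x ≢ y → Rep N x r → Rep N y r → ⊥

  RepByEdges : Fin nN → List (Elem G) → Set
  RepByEdges N S = ∀ x → x ∈ₗ S → Σ RElem λ r → Rep N x r × IsEdgeR r

{-# OPTIONS --safe #-}
-- Suppose D ≠ C were also central. Let t be the tree edge at D on the path
-- to C, and s₀ the tree edge at C on the path to D. Every tree edge is a
-- bridge, so the part of the tree beyond any other edge s at C lies beyond t
-- as seen from D, and avoids D; hence every element represented in C by an
-- edge other than the virtual edge of s₀ is represented in D by the virtual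
-- edge of t. By centrality of C at most one element of S is represented by
-- s₀, so two are represented by t in D, contradicting centrality of D.
--
-- That tree edges are bridges follows from the definition of the tree as a
-- connected graph with one node more than edges: a walk between the ends of
-- t avoiding t would join every node to a root without t, and the first
-- edges of shortest such walks, together with t, would inject the nodes
-- into the edges.
module Submission where

open import Defs
open import Data.Fin using (Fin; _≟_)
open import Data.Fin.Properties using (injective⇒≤)
open import Data.Fin.Subset using () renaming (_∈_ to _∈ₛ_)
open import Data.Nat using (ℕ; zero; suc; _≤_; _<_; _≤?_; s≤s)
open import Data.Nat.Properties using (≮⇒≥; <-asym; ≤-trans; ≤-refl; 1+n≰n)
open import Data.Product using (Σ; ∃; _×_; _,_; proj₁; proj₂)
open import Data.Sum using (_⊎_; inj₁; inj₂; [_,_])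
open import Data.Unit using (⊤; tt)
open import Data.Empty using (⊥; ⊥-elim)
open import Data.List using (List; _∷_; [])
open import Data.List.Membership.Propositional using (_∈_)
open import Data.List.Relation.Unary.Any using (here; there)
open import Function using (_∘_; id)
open import Relation.Binary.Definitions using (DecidableEquality)
open import Relation.Nullary using (¬_; yes; no)
open import Relation.Nullary.Decidable using (decidable-stable)
open import Relation.Binary.PropositionalEquality
  using (_≡_; _≢_; refl; sym; trans; subst)

SameEnds-swap : {V : Set} {p : V × V} {u w : V} → SameEnds p (u , w) → SameEnds p (w , u)
SameEnds-swap (inj₁ (a , b)) = inj₂ (a , b)
SameEnds-swap (inj₂ (a , b)) = inj₁ (a , b)

SameEnds-endpoint : {V : Set} {p : V × V} {u w x : V} → SameEnds p (u , w) →
                    (proj₁ p ≡ x) ⊎ (proj₂ p ≡ x) → (u ≡ x) ⊎ (w ≡ x)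
SameEnds-endpoint (inj₁ (refl , refl)) (inj₁ refl) = inj₁ refl
SameEnds-endpoint (inj₁ (refl , refl)) (inj₂ refl) = inj₂ refl
SameEnds-endpoint (inj₂ (refl , refl)) (inj₁ refl) = inj₂ refl
SameEnds-endpoint (inj₂ (refl , refl)) (inj₂ refl) = inj₁ refl

SameEnds-other : {V : Set} {p : V × V} {u w u' w' : V} →
                 SameEnds p (u , w) → SameEnds p (u' , w') → u ≢ u' → u' ≡ w × w' ≡ u
SameEnds-other (inj₁ (refl , refl)) (inj₁ (refl , refl)) u≢u' = ⊥-elim (u≢u' refl)
SameEnds-other (inj₁ (refl , refl)) (inj₂ (refl , refl)) _    = refl , refl
SameEnds-other (inj₂ (refl , refl)) (inj₁ (refl , refl)) _    = refl , refl
SameEnds-other (inj₂ (refl , refl)) (inj₂ (refl , refl)) u≢u' = ⊥-elim (u≢u' refl)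

SameEnds-first : {V : Set} {p : V × V} {u w : V} → SameEnds p (u , w) →
                 (proj₁ p ≡ u) ⊎ (proj₂ p ≡ u)
SameEnds-first (inj₁ (a , _)) = inj₁ a
SameEnds-first (inj₂ (_ , b)) = inj₂ b

¬¬-Π-Fin : ∀ n {P : Fin n → Set} → (∀ i → ¬ ¬ P i) → ¬ ¬ (∀ i → P i)
¬¬-Π-Fin zero    _   k = k λ ()
¬¬-Π-Fin (suc n) ¬¬P k =
  ¬¬P Fin.zero λ p₀ → ¬¬-Π-Fin n (¬¬P ∘ Fin.suc) λ ps →
    k λ { Fin.zero → p₀ ; (Fin.suc i) → ps i }

no-three-in-two-subsingletons :
  {X : Set} {A B : X → Set} →
  (∀ {a b} → a ≢ b → A a → A b → ⊥) → (∀ {a b} → a ≢ b → B a → B b → ⊥) →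
  {x y z : X} → x ≢ y → x ≢ z → y ≢ z → A x ⊎ B x → A y ⊎ B y → A z ⊎ B z → ⊥
no-three-in-two-subsingletons oneA oneB x≢y _ _ (inj₁ ax) (inj₁ ay) _ = oneA x≢y ax ay
no-three-in-two-subsingletons oneA _ _ x≢z _ (inj₁ ax) (inj₂ _) (inj₁ az) = oneA x≢z ax az
no-three-in-two-subsingletons _ oneB _ _ y≢z (inj₁ _) (inj₂ by) (inj₂ bz) = oneB y≢z by bz
no-three-in-two-subsingletons oneA _ _ _ y≢z (inj₂ _) (inj₁ ay) (inj₁ az) = oneA y≢z ay az
no-three-in-two-subsingletons _ oneB _ x≢z _ (inj₂ bx) (inj₁ _) (inj₂ bz) = oneB x≢z bx bz
no-three-in-two-subsingletons _ oneB x≢y _ _ (inj₂ bx) (inj₂ by) _ = oneB x≢y bx by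

module _ {V E : Set} {ends : E → V × V} where
  open Walk ends

  IncidentTo : E → V → Set
  IncidentTo e x = (proj₁ (ends e) ≡ x) ⊎ (proj₂ (ends e) ≡ x)

  infixr 5 _++_
  _++_ : ∀ {P Q u v w} → Reach P Q u v → Reach P Q v w → Reach P Q u w
  here                 ++ r = r
  step e q j pv rest   ++ r = step e q j pv (rest ++ r)

  reverse : ∀ {P Q u v} → P u → Reach P Q u v → Reach P Q v u
  reverse pu here                = here
  reverse pu (step e q j pv rest) = reverse pv rest ++ step e q (SameEnds-swap j) pu here

  map : ∀ {P Q P′ Q′ u v} → (∀ {x} → P x → P′ x) → (∀ {e} → Q e → Q′ e) →
        Reach P Q u v → Reach P′ Q′ u v
  map f g here                 = here
  map f g (step e q j pv rest) = step e (g q) j (f pv) (map f g rest)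

  allowed-end : ∀ {P Q u v} → P u → Reach P Q u v → P v
  allowed-end pu here                 = pu
  allowed-end pu (step e q j pv rest) = allowed-end pv rest

  length : ∀ {P Q u v} → Reach P Q u v → ℕ
  length here                 = 0
  length (step e q j pv rest) = suc (length rest)

  Shortest : (V → Set) → (E → Set) → V → V → Set
  Shortest P Q u v = Σ (Reach P Q u v) λ w → (w′ : Reach P Q u v) → ¬ length w′ < length w

  shortest-walk : ∀ {P Q u v} → Reach P Q u v → ¬ ¬ Shortest P Q u v
  shortest-walk {P} {Q} {u} {v} w = within (length w) w ≤-refl
    where
    within : ∀ k (w : Reach P Q u v) → length w ≤ k → ¬ ¬ Shortest P Q u v
    shorter : ∀ k (w : Reach P Q u v) → length w < k → ¬ ¬ Shortest P Q u v
    within k w w≤k none = none (w , λ w′ w′<w → shorter k w′ (≤-trans w′<w w≤k) none)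
    shorter (suc k) w (s≤s w≤k) = within k w w≤k

  reach-or-avoid : ∀ {P Q u v} (x : V) → DecidableEquality V → Reach P Q u v →
    Reach P Q u x ⊎ (u ≢ x × (∀ e → IncidentTo e x → Reach P (λ e′ → Q e′ × e′ ≢ e) u v))
  reach-or-avoid {u = u} x _≟ᵥ_ here with u ≟ᵥ x
  ... | yes refl = inj₁ here
  ... | no u≢x   = inj₂ (u≢x , λ _ _ → here)
  reach-or-avoid {u = u} x _≟ᵥ_ (step e q j pv rest) with u ≟ᵥ x
  ... | yes refl = inj₁ here
  ... | no u≢x with reach-or-avoid x _≟ᵥ_ rest
  ...   | inj₁ r            = inj₁ (step e q j pv r)
  ...   | inj₂ (v≢x , rest′) = inj₂ (u≢x , λ e′ e′∋x →
            step e (q , λ { refl → [ u≢x , v≢x ] (SameEnds-endpoint j e′∋x) }) j pv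
                 (rest′ e′ e′∋x))

  last-exit : ∀ {P Q u v} (x : V) → DecidableEquality V → x ≢ v → Reach P Q u v →
    (∃ λ e → ∃ λ w → SameEnds (ends e) (x , w) × Reach P (λ e′ → Q e′ × e′ ≢ e) w v)
    ⊎ (u ≢ x × (∀ e → IncidentTo e x → Reach P (λ e′ → Q e′ × e′ ≢ e) u v))
  last-exit x _ x≢v here = inj₂ (x≢v ∘ sym , λ _ _ → here)
  last-exit {u = u} x _≟ᵥ_ x≢v (step e q j pv rest) with last-exit x _≟ᵥ_ x≢v rest
  ... | inj₁ exit = inj₁ exit
  ... | inj₂ (w≢x , rest′) with u ≟ᵥ x
  ...   | yes refl = inj₁ (e , _ , j , rest′ e (SameEnds-first j))
  ...   | no u≢x = inj₂ (u≢x , λ e′ e′∋x →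
            step e (q , λ { refl → [ u≢x , w≢x ] (SameEnds-endpoint j e′∋x) }) j pv
                 (rest′ e′ e′∋x))

module _ {nV nE : ℕ} {ends : Fin nE → Fin nV × Fin nV} (t₀ : Fin nE) where
  open Walk ends

  Avoiding : Fin nV → Fin nV → Set
  Avoiding = Reach (λ _ → ⊤) (λ e → e ≢ t₀)

  module _ {r : Fin nV} (shortest : ∀ v → Shortest {ends = ends} (λ _ → ⊤) (λ e → e ≢ t₀) v r) where
    dist : Fin nV → ℕ
    dist v = length (proj₁ (shortest v))

    record Descent {v : Fin nV} (w : Avoiding v r) : Set where
      field
        edge   : Fin nE
        next   : Fin nV
        avoids : edge ≢ t₀
        joins  : SameEnds (ends edge) (v , next)
        closer : dist next < length w

    descent : ∀ {v} (w : Avoiding v r) → v ≢ r → Descent w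
    descent here v≢r = ⊥-elim (v≢r refl)
    descent (step e e≢t₀ j _ rest) _ = record
      { edge = e ; next = _ ; avoids = e≢t₀ ; joins = j
      ; closer = s≤s (≮⇒≥ (proj₂ (shortest _) rest)) }

    parent : Fin nV → Fin nE
    parent v with v ≟ r
    ... | yes _   = t₀
    ... | no v≢r = Descent.edge (descent (proj₁ (shortest v)) v≢r)

    descents-differ : ∀ {v v′} (d : Descent (proj₁ (shortest v)))
                      (d′ : Descent (proj₁ (shortest v′))) →
                      v ≢ v′ → Descent.edge d ≢ Descent.edge d′
    descents-differ d d′ v≢v′ refl
      with refl , refl ← SameEnds-other (Descent.joins d) (Descent.joins d′) v≢v′
      = <-asym (Descent.closer d) (Descent.closer d′)

    parent-injective : ∀ {v v′} → parent v ≡ parent v′ → v ≡ v′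
    parent-injective {v} {v′} eq with v ≟ r | v′ ≟ r
    ... | yes refl | yes refl = refl
    ... | yes _    | no v′≢r = ⊥-elim (Descent.avoids (descent (proj₁ (shortest v′)) v′≢r) (sym eq))
    ... | no v≢r   | yes _    = ⊥-elim (Descent.avoids (descent (proj₁ (shortest v)) v≢r) eq)
    ... | no v≢r   | no v′≢r with v ≟ v′
    ...   | yes v≡v′ = v≡v′
    ...   | no v≢v′  = ⊥-elim (descents-differ (descent _ v≢r) (descent _ v′≢r) v≢v′ eq)

  reachable-avoiding⇒vertices≤edges : (r : Fin nV) → (∀ v → Avoiding v r) → nV ≤ nE
  reachable-avoiding⇒vertices≤edges r reach = decidable-stable (nV ≤? nE) λ nV≰nE →
    ¬¬-Π-Fin nV (shortest-walk ∘ reach) λ shortest →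
      nV≰nE (injective⇒≤ (parent-injective shortest))

module _ {nN nT : ℕ} {tends : Fin nT → Fin nN × Fin nN}
         (connected : Walk.Connected tends (λ _ → ⊤) (λ _ → ⊤)) (size : nN ≡ suc nT) where
  open Walk tends

  tree-edge-is-bridge : ∀ t → ¬ Avoiding t (proj₁ (tends t)) (proj₂ (tends t))
  tree-edge-is-bridge t around = 1+n≰n (subst (_≤ nT) size
    (reachable-avoiding⇒vertices≤edges t p λ v → reroute (connected v p tt tt)))
    where
    p : Fin nN
    p = proj₁ (tends t)

    reroute : ∀ {u v} → Reach (λ _ → ⊤) (λ _ → ⊤) u v → Avoiding t u v
    reroute here = here
    reroute (step e _ j _ rest) with e ≟ t
    ... | no e≢t = step e e≢t j tt (reroute rest)
    reroute (step e _ (inj₁ (refl , refl)) _ rest) | yes refl = around ++ reroute rest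
    reroute (step e _ (inj₂ (refl , refl)) _ rest) | yes refl = reverse tt around ++ reroute rest

module _ {G : Graph} {T : TreeData G} (spqr : IsSPQRTree T) where
  open Graph G
  open TreeData T
  open IsSPQRTree spqr
  open Walk tends

  Beyond : Fin nN → Fin nT → Fin nN → Set
  Beyond N t M = ∃ λ w → SameEnds (tends t) (N , w) × ReachAvoiding T t w M

  Beyond⇒InB : ∀ {N t M} → Beyond N t M → InB T N t M
  Beyond⇒InB (_ , inj₁ (N≡ , refl) , walk) = inj₁ (N≡ , walk)
  Beyond⇒InB (_ , inj₂ (refl , N≡) , walk) = inj₂ (N≡ , walk)

  InB⇒Beyond : ∀ {N t M} → InB T N t M → Beyond N t M
  InB⇒Beyond (inj₁ (N≡ , walk)) = _ , inj₁ (N≡ , refl) , walk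
  InB⇒Beyond (inj₂ (N≡ , walk)) = _ , inj₂ (refl , N≡) , walk

  tree-edge-separates : ∀ {t p q} → SameEnds (tends t) (p , q) → ¬ ReachAvoiding T t p q
  tree-edge-separates {t} (inj₁ (refl , refl)) = tree-edge-is-bridge treeConnected treeSize t
  tree-edge-separates {t} (inj₂ (refl , refl)) =
    tree-edge-is-bridge treeConnected treeSize t ∘ reverse tt

  toward : ∀ {D C} → D ≢ C → ∃ λ t → Beyond D t C
  toward {D} {C} D≢C with last-exit D _≟_ D≢C (treeConnected D C tt tt)
  ... | inj₁ (t , w , j , walk) = t , w , j , map (λ _ → tt) proj₂ walk
  ... | inj₂ (D≢D , _)          = ⊥-elim (D≢D refl)

  module _ {C D : Fin nN} (C≢D : C ≢ D) {t : Fin nT} (C-beyond-t : Beyond D t C)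
           {s₀ : Fin nT} (D-beyond-s₀ : Beyond C s₀ D) where

    t-at-D : Incident T t D
    t-at-D = SameEnds-first (proj₁ (proj₂ C-beyond-t))

    module _ {s : Fin nT} (s≢s₀ : s ≢ s₀) {w : Fin nN} (s-joins : SameEnds (tends s) (C , w)) where

      C-reaches-D-avoiding : ReachAvoiding T s C D
      C-reaches-D-avoiding = reach D-beyond-s₀
        where
        reach : Beyond C s₀ D → ReachAvoiding T s C D
        reach (_ , s₀-joins , walk) with reach-or-avoid C _≟_ walk
        ... | inj₁ back        = ⊥-elim (tree-edge-separates s₀-joins (reverse tt back))
        ... | inj₂ (_ , avoid) =
              step s₀ (s≢s₀ ∘ sym) s₀-joins tt (map id proj₂ (avoid s (SameEnds-first s-joins)))

      D-not-beyond : ¬ ReachAvoiding T s w D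
      D-not-beyond walk = tree-edge-separates s-joins (C-reaches-D-avoiding ++ reverse tt walk)

      beyond-≢D : ∀ {M} → ReachAvoiding T s w M → M ≢ D
      beyond-≢D walk refl = D-not-beyond walk

      s≢t : s ≢ t
      s≢t refl with SameEnds-endpoint s-joins t-at-D
      ... | inj₁ C≡D  = C≢D C≡D
      ... | inj₂ refl = D-not-beyond here

      beyond-s⇒beyond-t : ∀ {M} → ReachAvoiding T s w M → Beyond D t M
      beyond-s⇒beyond-t {M} walk with reach-or-avoid D _≟_ walk
      ... | inj₁ to-D        = ⊥-elim (D-not-beyond to-D)
      ... | inj₂ (_ , avoid) = extend C-beyond-t
        where
        extend : Beyond D t C → Beyond D t M
        extend (w′ , t-joins , to-C) =
          w′ , t-joins , to-C ++ step s s≢t s-joins tt (map id proj₂ (avoid t t-at-D))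

      vertex-beyond-∉D : ∀ {M v} → ReachAvoiding T s w M →
                         ¬ v ∈ₛ vin C → v ∈ₛ vin M → ¬ v ∈ₛ vin D
      vertex-beyond-∉D {M} {v} walk v∉C v∈M v∈D
        with reach-or-avoid C _≟_ (vertexSubtree v M D v∈M v∈D)
      ... | inj₁ to-C        = v∉C (allowed-end v∈M to-C)
      ... | inj₂ (_ , avoid) =
            D-not-beyond (walk ++ map (λ _ → tt) proj₂ (avoid s (SameEnds-first s-joins)))

    rep-via-s⇒rep-via-t : ∀ {a s} → s ≢ s₀ → Rep T C a (rt s) → Rep T D a (rt t)
    rep-via-s⇒rep-via-t {edg e} s≢s₀ (rep-t _ _ inGsub _ _)
      with w , s-joins , walk ← InB⇒Beyond inGsub
      = rep-t t-at-D (beyond-≢D s≢s₀ s-joins walk)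
              (Beyond⇒InB (beyond-s⇒beyond-t s≢s₀ s-joins walk)) (λ ()) (λ ())
    rep-via-s⇒rep-via-t {vtx v} s≢s₀ (rep-t _ v∉C (M , inB , v∈M) _ _)
      with w , s-joins , walk ← InB⇒Beyond inB
      = rep-t t-at-D v∉D (M , Beyond⇒InB (beyond-s⇒beyond-t s≢s₀ s-joins walk) , v∈M)
              (λ { refl → v∉D (proj₁ t-ends∈D) }) (λ { refl → v∉D (proj₂ t-ends∈D) })
      where
      v∉D : ¬ v ∈ₛ vin D
      v∉D = vertex-beyond-∉D s≢s₀ s-joins walk v∉C v∈M
      t-ends∈D : (proj₁ (vends t) ∈ₛ vin D) × (proj₂ (vends t) ∈ₛ vin D)
      t-ends∈D = skelEnds D (inj₂ t) t-at-D

    edge-rep⇒via-s₀⊎via-t : ∀ {a r} → Rep T C a r → IsEdgeR T r →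
                       Rep T C a (rt s₀) ⊎ Rep T D a (rt t)
    edge-rep⇒via-s₀⊎via-t (rep-e home≡C) _ =
      inj₂ (rep-t t-at-D (C≢D ∘ trans (sym home≡C))
                  (Beyond⇒InB (subst (Beyond D t) (sym home≡C) C-beyond-t)) (λ ()) (λ ()))
    edge-rep⇒via-s₀⊎via-t rep@(rep-t {t = s} _ _ _ _ _) _ with s ≟ s₀
    ... | yes refl = inj₁ rep
    ... | no s≢s₀  = inj₂ (rep-via-s⇒rep-via-t s≢s₀ rep)

lemma4 : (G : Graph) → Biconnected G → ¬ SingleEdge G →
         (T : TreeData G) → IsSPQRTree T →
         (x y z : Elem G) → x ≢ y → x ≢ z → y ≢ z →
         (C : Fin (TreeData.nN T)) →
         Central T C (x ∷ y ∷ z ∷ []) → RepByEdges T C (x ∷ y ∷ z ∷ []) →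
         (D : Fin (TreeData.nN T)) → Central T D (x ∷ y ∷ z ∷ []) → D ≡ C
lemma4 G _ _ T spqr x y z x≢y x≢z y≢z C central-C by-edges D central-D with D ≟ C
... | yes D≡C = D≡C
... | no D≢C
  with t , C-beyond-t ← toward spqr D≢C
     | s₀ , D-beyond-s₀ ← toward spqr (D≢C ∘ sym)
  = ⊥-elim (no-three-in-two-subsingletons {A = ViaS₀} {B = ViaT}
      (λ a≢b (a∈S , ra) (b∈S , rb) → central-C _ _ _ a∈S b∈S a≢b ra rb)
      (λ a≢b (a∈S , ra) (b∈S , rb) → central-D _ _ _ a∈S b∈S a≢b ra rb)
      x≢y x≢z y≢z
      (classify (here refl)) (classify (there (here refl))) (classify (there (there (here refl)))))
  where
  S : List (Elem G)
  S = x ∷ y ∷ z ∷ []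

  ViaS₀ ViaT : Elem G → Set
  ViaS₀ a = a ∈ S × Rep T C a (rt s₀)
  ViaT  a = a ∈ S × Rep T D a (rt t)

  classify : ∀ {a} → a ∈ S → ViaS₀ a ⊎ ViaT a
  classify {a} a∈S with by-edges a a∈S
  ... | _ , rep , is-edge =
        Data.Sum.map (a∈S ,_) (a∈S ,_)
          (edge-rep⇒via-s₀⊎via-t spqr (D≢C ∘ sym) C-beyond-t D-beyond-s₀ rep is-edge)
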